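{- Let $n$, $a$, $q$ and $k$ be integers such that $n=qa$, $q\ge 3$ and $a\ge 4$. Then $$\beta_b(\overrightarrow{C}(n;1,a)) = \beta_b(\overrightarrow{C}(n;1,-(q-1)a)) = \begin{cases} (q+k)(a-2) & \text{if } q=k(a-1),\ k\ge 1,\\ a(q-1) & \text{if } a=kq+1,\ k\ge 2.\end{cases}$$
   Context: For integers $n\ge 3$ and $b_1,\dots,b_k$, the oriented circulant graph $\overrightarrow{C}(n;b_1,\dots,b_k)$ has vertex set $\{v_0,\dots,v_{n-1}\}$ and arc set $\{v_iv_{i+b_j} : 0\le i\le n-1,\ 1\le j\le k\}$, with subscripts taken modulo $n$ (negative $b_j$ allowed). $d(u,v)$ is the length of a shortest directed path from $u$ to $v$; $e(v)=\max_u d(v,u)$ is the eccentricity; $\mathrm{diam}$ is the maximum eccentricity. An independent broadcast on an oriented graph $\overrightarrow{G}$ is a function $f:V(\overrightarrow{G})\to\{0,\dots,\mathrm{diam}(\overrightarrow{G})\}$ with $f(v)\le e(v)$ for all $v$, and $d(u,v)>f(u)$ for all distinct $u,v$ with $f(u),f(v)>0$. Its cost is $\sigma(f)=\sum_v f(v)$, and $\beta_b(\overrightarrow{G})$ is the maximum cost of an independent broadcast on $\overrightarrow{G}$. -}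

module Defs where

open import Data.Nat using (ℕ; zero; suc; _+_; _≤_; _<_)
open import Data.Fin using (Fin; toℕ)
open import Data.Integer as ℤ using (ℤ; +_)
open import Data.Integer.Divisibility using (_∣_)
open import Data.List using (List; tabulate)
open import Data.Nat.ListAction using (sum)
open import Data.List.Membership.Propositional using (_∈_)
open import Data.Product using (Σ; ∃; _×_; _,_)
open import Relation.Binary.PropositionalEquality using (_≡_)
open import Relation.Nullary using (¬_)

Arc : (n : ℕ) → List ℤ → Fin n → Fin n → Set
Arc n bs u v = ∃ λ b → b ∈ bs × ((+ n) ∣ ((+ toℕ v) ℤ.- ((+ toℕ u) ℤ.+ b)))

data Walk (n : ℕ) (bs : List ℤ) : ℕ → Fin n → Fin n → Set where
  here : ∀ {u} → Walk n bs zero u u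
  step : ∀ {m u w v} → Arc n bs u w → Walk n bs m w v → Walk n bs (suc m) u v

Dist : (n : ℕ) → List ℤ → Fin n → Fin n → ℕ → Set
Dist n bs u v m = Walk n bs m u v × (∀ m' → m' < m → ¬ Walk n bs m' u v)

Ecc : (n : ℕ) → List ℤ → Fin n → ℕ → Set
Ecc n bs v ε = (∀ u m → Dist n bs v u m → m ≤ ε) × (∃ λ u → Dist n bs v u ε)

Diam : (n : ℕ) → List ℤ → ℕ → Set
Diam n bs δ = (∀ v ε → Ecc n bs v ε → ε ≤ δ) × (∃ λ v → Ecc n bs v δ)

IndependentBroadcast : (n : ℕ) → List ℤ → (Fin n → ℕ) → Set
IndependentBroadcast n bs f =
  (∀ v δ → Diam n bs δ → f v ≤ δ) ×
  (∀ v ε → Ecc n bs v ε → f v ≤ ε) ×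
  (∀ u v → ¬ (u ≡ v) → 0 < f u → 0 < f v → ∀ m → Dist n bs u v m → f u < m)

cost : (n : ℕ) → (Fin n → ℕ) → ℕ
cost n f = sum (tabulate f)

BroadcastIndependence : (n : ℕ) → List ℤ → ℕ → Set
BroadcastIndependence n bs β =
  (Σ (Fin n → ℕ) λ f → IndependentBroadcast n bs f × cost n f ≡ β) ×
  (∀ f → IndependentBroadcast n bs f → cost n f ≤ β)

-- Both jump sets give C(n; 1, a): since −(q−1)a ≡ a (mod n), each vertex v_i has arcs to v_{i+1} and
-- v_{i+a}. A shortest walk from v_i to v_{i+D} (0 ≤ D < n) takes D mod a unit steps and ⌊D/a⌋ jumps, so
-- every vertex has eccentricity (a−1) + (q−1). For the upper bounds, each broadcasting vertex is charged
-- to the gap D that separates it from the next broadcasting vertex around the cycle; the gaps add up to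
-- the length of the cycle. When q = k(a−1) a vertex of value F needs (a−1)F ≤ (a−2)D, giving
-- (a−1)·cost ≤ (a−2)n. Otherwise the vertices are split into the a residue classes mod a, each a cycle of
-- q vertices joined by jumps. A class is either light (total ≤ q−1) or holds exactly one broadcasting
-- vertex, and charging the class totals around ℤ_a gives cost ≤ a(q−1). Broadcasting c−1 from every
-- multiple of c (with c = a−1, resp. c = q) is independent: c ∣ a−1, so a walk between two multiples of
-- c has length divisible by c.

module Submission where

open import Defs
open import Data.Fin using (Fin; toℕ; fromℕ<)
open import Data.Fin.Properties using (toℕ<n; toℕ-fromℕ<; toℕ-injective)
open import Data.Integer using (ℤ; +_; -_; _⊖_; ∣_∣) renaming (_+_ to _ℤ+_; _-_ to _ℤ-_)
open import Data.Integer.Divisibility using () renaming (_∣_ to _ℤ∣_)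
import Data.Integer.Divisibility.Signed as Signed
import Data.Integer.Properties as ℤP
import Data.Integer.Tactic.RingSolver as ℤ-Solver
open import Data.List using (List; _∷_; []; applyUpTo; tabulate)
open import Data.List.Properties using (tabulate-cong)
import Data.List.Relation.Unary.Any as Any
open import Data.Nat
open import Data.Nat.DivMod
open import Data.Nat.Divisibility
  using (_∣_; divides; _∣0; _∣?_; ∣-refl; n∣m*n; ∣⇒≤; ∣m+n∣m⇒∣n; ∣m⇒∣m*n; ∣n∣m%n⇒∣m)
open import Data.Nat.ListAction using (sum)
open import Data.Nat.Properties
open import Data.Nat.Tactic.RingSolver using (solve-∀)
open import Algebra.Properties.CommutativeSemigroup +-commutativeSemigroup
  using (interchange; x∙yz≈y∙xz; xy∙z≈y∙xz)
open import Data.Product using (∃; ∃₂; _×_; _,_; proj₁; proj₂)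
open import Data.Sum using (_⊎_; inj₁; inj₂)
import Data.Sum as Sum
open import Function using (_∘_; _⇔_; mk⇔; Equivalence)
open import Function.Properties.Equivalence using (⇔-setoid)
open import Level using (0ℓ)
open import Relation.Binary.PropositionalEquality
import Relation.Binary.Reasoning.Setoid as SetoidReasoning
open import Relation.Nullary using (¬_; yes; no; contradiction)

∑ : (ℕ → ℕ) → ℕ → ℕ
∑ w k = sum (applyUpTo w k)

syntax ∑ (λ i → e) k = ∑[ i < k ] e

∑-cong : ∀ {g h : ℕ → ℕ} k → (∀ i → i < k → g i ≡ h i) → ∑ g k ≡ ∑ h k
∑-cong zero    eq = refl
∑-cong (suc k) eq = cong₂ _+_ (eq 0 z<s) (∑-cong k (λ i i<k → eq (suc i) (s<s i<k)))

∑-distrib-+ : ∀ (g h : ℕ → ℕ) k → ∑[ i < k ] (g i + h i) ≡ ∑ g k + ∑ h k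
∑-distrib-+ g h zero    = refl
∑-distrib-+ g h (suc k) =
  trans (cong (_+_ (g 0 + h 0)) (∑-distrib-+ (g ∘ suc) (h ∘ suc) k))
        (interchange (g 0) (h 0) (∑ (g ∘ suc) k) (∑ (h ∘ suc) k))

∑-split : ∀ (w : ℕ → ℕ) k l → ∑ w (k + l) ≡ ∑ w k + ∑[ i < l ] w (k + i)
∑-split w zero    l = refl
∑-split w (suc k) l = trans (cong (_+_ (w 0)) (∑-split (w ∘ suc) k l)) (sym (+-assoc (w 0) _ _))

∑-+-suc : ∀ (w : ℕ → ℕ) r k → ∑[ i < k ] w (r + suc i) ≡ ∑[ i < k ] w (suc r + i)
∑-+-suc w r k = ∑-cong k λ i _ → cong w (+-suc r i)

∑-zero : ∀ (w : ℕ → ℕ) k → (∀ i → i < k → w i ≡ 0) → ∑ w k ≡ 0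
∑-zero w zero    eq = refl
∑-zero w (suc k) eq rewrite eq 0 z<s = ∑-zero (w ∘ suc) k (λ i i<k → eq (suc i) (s<s i<k))

∑-const : ∀ c k → ∑[ _ < k ] c ≡ k * c
∑-const c zero    = refl
∑-const c (suc k) = cong (_+_ c) (∑-const c k)

∑-single : ∀ (w : ℕ → ℕ) {k} s → s < k → (∀ i → i < k → i ≢ s → w i ≡ 0) → ∑ w k ≡ w s
∑-single w {suc k} zero    _   eq =
  trans (cong (_+_ (w 0)) (∑-zero (w ∘ suc) k (λ i i<k → eq (suc i) (s<s i<k) λ ())))
        (+-identityʳ (w 0))
∑-single w {suc k} (suc s) s<k eq rewrite eq 0 z<s (λ ()) =
  ∑-single (w ∘ suc) s (s<s⁻¹ s<k) (λ i i<k i≢s → eq (suc i) (s<s i<k) (i≢s ∘ suc-injective))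

∑-pos : ∀ (w : ℕ → ℕ) k → 0 < ∑ w k → ∃ λ i → i < k × 0 < w i
∑-pos w (suc k) pos with w 0 in w0
... | suc _ = 0 , z<s , subst (0 <_) (sym w0) z<s
... | zero with ∑-pos (w ∘ suc) k pos
...   | i , i<k , wi = suc i , s<s i<k , wi

∑-comm : ∀ (w : ℕ → ℕ → ℕ) k l → ∑[ i < k ] ∑ (w i) l ≡ ∑[ j < l ] ∑[ i < k ] w i j
∑-comm w zero    l = sym (∑-zero _ l (λ _ _ → refl))
∑-comm w (suc k) l =
  trans (cong (_+_ (∑ (w 0) l)) (∑-comm (w ∘ suc) k l))
        (sym (∑-distrib-+ (w 0) (λ j → ∑[ i < k ] w (suc i) j) l))

∑-blocks : ∀ (w : ℕ → ℕ) k l → ∑ w (k * l) ≡ ∑[ i < k ] ∑[ j < l ] w (i * l + j)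
∑-blocks w zero    l = refl
∑-blocks w (suc k) l = begin
  ∑ w (l + k * l)                                         ≡⟨ ∑-split w l (k * l) ⟩
  ∑ w l + ∑[ i < k * l ] w (l + i)                        ≡⟨ cong (_+_ (∑ w l)) (∑-blocks (λ i → w (l + i)) k l) ⟩
  ∑ w l + ∑[ i < k ] ∑[ j < l ] w (l + (i * l + j))       ≡⟨ cong (_+_ (∑ w l)) (∑-cong k λ i _ → ∑-cong l λ j _ →
                                                               cong w (sym (+-assoc l (i * l) j))) ⟩
  ∑ w l + ∑[ i < k ] ∑[ j < l ] w (suc i * l + j)         ∎
  where open ≡-Reasoning

tabulate-toℕ : ∀ {A : Set} k (g : ℕ → A) → tabulate {n = k} (g ∘ toℕ) ≡ applyUpTo g k
tabulate-toℕ zero    g = refl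
tabulate-toℕ (suc k) g = cong (g 0 ∷_) (tabulate-toℕ k (g ∘ suc))

least-positive : ∀ (w : ℕ → ℕ) N →
  (∀ i → i < N → w i ≡ 0) ⊎ ∃ λ p → p < N × 0 < w p × (∀ i → i < p → w i ≡ 0)
least-positive w zero = inj₁ λ _ ()
least-positive w (suc N) with w 0 in w0
... | suc _ = inj₂ (0 , z<s , subst (0 <_) (sym w0) z<s , λ _ ())
... | zero with least-positive (w ∘ suc) N
...   | inj₁ zeros = inj₁ λ { zero _ → w0 ; (suc i) i<N → zeros i (s<s⁻¹ i<N) }
...   | inj₂ (p , p<N , wp , below) =
          inj₂ (suc p , s<s p<N , wp , λ { zero _ → w0 ; (suc i) i<p → below i (s<s⁻¹ i<p) })

data CyclicGap (N i j D : ℕ) : Set where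
  ahead  : i < j → i + D ≡ j → CyclicGap N i j D
  around : j ≤ i → i + D ≡ N + j → CyclicGap N i j D

CyclicGap⇒offset : ∀ {N i j D} → CyclicGap N i j D → i + D ≡ j ⊎ i + D ≡ N + j
CyclicGap⇒offset (ahead _ e)  = inj₁ e
CyclicGap⇒offset (around _ e) = inj₂ e

CyclicGap-≤ : ∀ {N i j D} → j < N → CyclicGap N i j D → D ≤ N
CyclicGap-≤ {N} {i} j<N (ahead _ e)    = ≤-trans (m≤n+m _ i) (≤-trans (≤-reflexive e) (<⇒≤ j<N))
CyclicGap-≤ {N} {i} {j} {D} _ (around j≤i e) = +-cancelʳ-≤ i D N (begin
  D + i   ≡⟨ +-comm D i ⟩
  i + D   ≡⟨ e ⟩
  N + j   ≤⟨ +-monoʳ-≤ N j≤i ⟩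
  N + i   ∎)
  where open ≤-Reasoning

CyclicGap-self : ∀ {N i D} → CyclicGap N i i D → D ≡ N
CyclicGap-self (ahead i<i _)  = contradiction i<i (<-irrefl refl)
CyclicGap-self {N} {i} (around _ e) = +-cancelˡ-≡ i _ _ (trans e (+-comm N i))

CyclicGap-pos : ∀ {N i j D} → i < N → CyclicGap N i j D → 0 < D
CyclicGap-pos {D = zero} _   (ahead i<j e)  = contradiction (trans (sym (+-identityʳ _)) e) (<⇒≢ i<j)
CyclicGap-pos {D = zero} i<N (around j≤i e) =
  contradiction (≤-trans (m≤m+n _ _) (≤-reflexive (trans (sym e) (+-identityʳ _)))) (<⇒≱ i<N)
CyclicGap-pos {D = suc _} _ _ = z<s

-- Each positive weight is paid for by the gap to the next positive index; the gaps sum to N.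
module _ {N : ℕ} (α β : ℕ) {w : ℕ → ℕ}
  (gap-bound : ∀ {i j D} → i < N → j < N → 0 < w i → 0 < w j → CyclicGap N i j D → α * w i ≤ β * D)
  where

  private
    module FromLeast (p : ℕ) (p<N : p < N) (wp : 0 < w p) (below : ∀ i → i < p → w i ≡ 0) where

      -- The scan runs downwards; v is a positive index ≥ r, or the least positive index p one turn later.
      Upcoming : ℕ → ℕ → Set
      Upcoming r v = r ≤ v × (v < N × 0 < w v ⊎ v ≡ N + p)

      p≤positive : ∀ {i} → 0 < w i → p ≤ i
      p≤positive {i} wi = ≮⇒≥ λ i<p → contradiction (below i i<p) (≢-sym (<⇒≢ wi))

      p≤upcoming : ∀ {r v} → Upcoming r v → p ≤ v
      p≤upcoming (_ , inj₁ (_ , wv)) = p≤positive wv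
      p≤upcoming (_ , inj₂ refl)     = m≤n+m p N

      step-bound : ∀ {r v} → r < N → 0 < w r → Upcoming (suc r) v → α * w r + β * r ≤ β * v
      step-bound {r} {v} r<N wr (r<v , next) = begin
        α * w r + β * r        ≤⟨ +-monoˡ-≤ (β * r) (gap next) ⟩
        β * (v ∸ r) + β * r    ≡⟨ sym (*-distribˡ-+ β (v ∸ r) r) ⟩
        β * (v ∸ r + r)        ≡⟨ cong (β *_) (m∸n+n≡m (<⇒≤ r<v)) ⟩
        β * v                  ∎
        where
        open ≤-Reasoning
        r+[v∸r]≡v : r + (v ∸ r) ≡ v
        r+[v∸r]≡v = m+[n∸m]≡n (<⇒≤ r<v)
        gap : v < N × 0 < w v ⊎ v ≡ N + p → α * w r ≤ β * (v ∸ r)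
        gap (inj₁ (v<N , wv)) = gap-bound r<N v<N wr wv (ahead r<v r+[v∸r]≡v)
        gap (inj₂ refl)       = gap-bound r<N p<N wr wp (around (p≤positive wr) r+[v∸r]≡v)

      scan : ∀ k r → r + k ≡ N → ∃ λ v → Upcoming r v × α * ∑[ i < k ] w (r + i) + β * v ≤ β * (N + p)
      scan zero r r+0≡N =
        N + p , (≤-trans (≤-reflexive (trans (sym (+-identityʳ r)) r+0≡N)) (m≤m+n N p) , inj₂ refl) ,
        ≤-reflexive (cong (_+ β * (N + p)) (*-zeroʳ α))
      scan (suc k) r r+k≡N with scan k (suc r) (trans (sym (+-suc r k)) r+k≡N)
      ... | v , next@(r<v , _) , bound with w (r + 0) in wr
      ... | zero  rewrite ∑-+-suc w r k = v , (<⇒≤ r<v , proj₂ next) , bound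
      ... | suc m rewrite ∑-+-suc w r k = r , (≤-refl , inj₁ (r<N , r-positive)) , (begin
        α * (suc m + T) + β * r   ≡⟨ regroup α (suc m) T β r ⟩
        α * suc m + β * r + α * T ≤⟨ +-monoˡ-≤ (α * T) r-step ⟩
        β * v + α * T             ≡⟨ +-comm (β * v) (α * T) ⟩
        α * T + β * v             ≤⟨ bound ⟩
        β * (N + p)               ∎)
        where
        open ≤-Reasoning
        T : ℕ
        T = ∑[ i < k ] w (suc r + i)
        r<N : r < N
        r<N = subst (r <_) r+k≡N (m<m+n r z<s)
        wr≡ : w r ≡ suc m
        wr≡ = trans (cong w (sym (+-identityʳ r))) wr
        r-positive : 0 < w r
        r-positive = subst (0 <_) (sym wr≡) z<s
        r-step : α * suc m + β * r ≤ β * v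
        r-step = subst (λ x → α * x + β * r ≤ β * v) wr≡ (step-bound r<N r-positive next)
        regroup : ∀ α x t β r → α * (x + t) + β * r ≡ α * x + β * r + α * t
        regroup = solve-∀

  ∑-cyclic-gap-bound : α * ∑ w N ≤ β * N
  ∑-cyclic-gap-bound with least-positive w N
  ... | inj₁ zeros = subst (λ s → α * s ≤ β * N) (sym (∑-zero w N zeros))
                           (subst (_≤ β * N) (sym (*-zeroʳ α)) z≤n)
  ... | inj₂ (p , p<N , wp , below) with FromLeast.scan p p<N wp below N 0 refl
  ...   | v , next , bound = +-cancelʳ-≤ (β * p) (α * ∑ w N) (β * N) (begin
    α * ∑ w N + β * p   ≤⟨ +-monoʳ-≤ (α * ∑ w N) (*-monoʳ-≤ β (FromLeast.p≤upcoming p p<N wp below next)) ⟩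
    α * ∑ w N + β * v   ≤⟨ bound ⟩
    β * (N + p)         ≡⟨ *-distribˡ-+ β N p ⟩
    β * N + β * p       ∎)
    where open ≤-Reasoning

unit-jump-gap-bound : ∀ {a F x y} → 3 ≤ a → F < x + y → x < a → (a ∸ 1) * F ≤ (a ∸ 2) * (x + y * a)
unit-jump-gap-bound {suc (suc (suc c))} {F} {x} {y} (s≤s (s≤s (s≤s _))) F<x+y x<a = +-cancelʳ-≤ (suc b) _ _ (begin
  suc b * F + suc b                  ≡⟨ trans (+-comm (suc b * F) (suc b)) (sym (*-suc (suc b) F)) ⟩
  suc b * suc F                      ≤⟨ *-monoʳ-≤ (suc b) F<x+y ⟩
  suc b * (x + y)                    ≡⟨ expand b x y ⟩
  b * x + x + suc b * y              ≤⟨ +-mono-≤ (+-monoʳ-≤ (b * x) (s≤s⁻¹ x<a)) (*-monoˡ-≤ y b+1≤b*[b+2]) ⟩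
  b * x + suc b + b * suc (suc b) * y ≡⟨ collect b x y ⟩
  b * (x + y * suc (suc b)) + suc b  ∎)
  where
  open ≤-Reasoning
  b : ℕ
  b = suc c
  b+1≤b*[b+2] : suc b ≤ b * suc (suc b)
  b+1≤b*[b+2] = s≤s (s≤s (m≤n⇒m≤1+n (m≤m+n c _)))
  expand : ∀ b x y → suc b * (x + y) ≡ b * x + x + suc b * y
  expand = solve-∀
  collect : ∀ b x y → b * x + suc b + b * suc (suc b) * y ≡ b * (x + y * suc (suc b)) + suc b
  collect = solve-∀

q*a≡[q+k]*[a∸1] : ∀ {q a k} → 1 ≤ a → q ≡ k * (a ∸ 1) → q * a ≡ (q + k) * (a ∸ 1)
q*a≡[q+k]*[a∸1] {q} {suc a'} {k} _ q≡k*a' = begin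
  q * suc a'        ≡⟨ *-suc q a' ⟩
  q + q * a'        ≡⟨ +-comm q (q * a') ⟩
  q * a' + q        ≡⟨ cong (_+_ (q * a')) q≡k*a' ⟩
  q * a' + k * a'   ≡⟨ sym (*-distribʳ-+ a' q k) ⟩
  (q + k) * a'      ∎
  where open ≡-Reasoning

self-gap-bound₁ : ∀ {a q k F} → 3 ≤ a → 1 ≤ q → q ≡ k * (a ∸ 1) →
  F ≤ (a ∸ 1) + (q ∸ 1) → (a ∸ 1) * F ≤ (a ∸ 2) * (q * a)
self-gap-bound₁ {_} {_} {zero} _ 1≤q q≡0 _ = contradiction q≡0 (≢-sym (<⇒≢ 1≤q))
self-gap-bound₁ {a@(suc (suc (suc c)))} {q@(suc q')} {k@(suc _)} {F} (s≤s (s≤s (s≤s _))) _ q≡k*[a∸1] F≤ecc =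
  begin
  suc b * F                ≤⟨ *-monoʳ-≤ (suc b) F≤b*[q+k] ⟩
  suc b * (b * (q + k))    ≡⟨ rearrange (suc b) b (q + k) ⟩
  b * ((q + k) * suc b)    ≡⟨ cong (b *_) (sym (q*a≡[q+k]*[a∸1] (s≤s z≤n) q≡k*[a∸1])) ⟩
  b * (q * a)              ∎
  where
  open ≤-Reasoning
  b : ℕ
  b = suc c
  rearrange : ∀ x y z → x * (y * z) ≡ y * (z * x)
  rearrange = solve-∀
  F≤b*[q+k] : F ≤ b * (q + k)
  F≤b*[q+k] = begin
    F               ≤⟨ F≤ecc ⟩
    suc b + q'      ≡⟨ sym (+-suc b q') ⟩
    b + q           ≤⟨ +-mono-≤ (m≤m*n b k) (m≤n*m q b) ⟩
    b * k + b * q   ≡⟨ trans (+-comm (b * k) (b * q)) (sym (*-distribˡ-+ b q k)) ⟩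
    b * (q + k)     ∎

column-gap-bound : ∀ {q F D} → F < D → D ≤ q → q * F ≤ (q ∸ 1) * D
column-gap-bound {zero} {F} {zero} () z≤n
column-gap-bound {suc q'} {F} {D} F<D D≤q = +-cancelʳ-≤ D _ _ (begin
  suc q' * F + D        ≤⟨ +-monoʳ-≤ (suc q' * F) D≤q ⟩
  suc q' * F + suc q'   ≡⟨ trans (+-comm (suc q' * F) (suc q')) (sym (*-suc (suc q') F)) ⟩
  suc q' * suc F        ≤⟨ *-monoʳ-≤ (suc q') F<D ⟩
  suc q' * D            ≡⟨ +-comm D (q' * D) ⟩
  q' * D + D            ∎)
  where open ≤-Reasoning

residue-gap-bound : ∀ {q F D y} → 2 ≤ q → 1 ≤ D → F < D + y → y < q → F ≤ (q ∸ 1) * D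
residue-gap-bound {suc (suc q'')} {F} {D} {y} (s≤s (s≤s _)) 1≤D F<D+y y<q = s≤s⁻¹ (begin
  suc F                  ≤⟨ F<D+y ⟩
  D + y                  ≤⟨ +-monoʳ-≤ D (s≤s⁻¹ y<q) ⟩
  D + suc q''            ≤⟨ +-monoʳ-≤ D (s≤s (m≤m*n q'' D {{>-nonZero 1≤D}})) ⟩
  D + suc (q'' * D)      ≡⟨ +-suc D (q'' * D) ⟩
  suc (suc q'' * D)      ∎)
  where open ≤-Reasoning

self-gap-bound₂ : ∀ {a q F} → 1 ≤ a → 2 ≤ q → F ≤ (a ∸ 1) + (q ∸ 1) → F ≤ (q ∸ 1) * a
self-gap-bound₂ {suc a'} {suc (suc q'')} {F} _ (s≤s (s≤s _)) F≤ecc = begin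
  F                          ≤⟨ F≤ecc ⟩
  a' + suc q''               ≡⟨ +-suc a' q'' ⟩
  suc a' + q''               ≤⟨ +-monoʳ-≤ (suc a') (m≤m*n q'' (suc a')) ⟩
  suc a' + q'' * suc a'      ∎
  where open ≤-Reasoning

m∸1<m : ∀ m .{{_ : NonZero m}} → m ∸ 1 < m
m∸1<m (suc m) = n<1+n m

[m∸1]*n+n≡m*n : ∀ m n .{{_ : NonZero m}} → (m ∸ 1) * n + n ≡ m * n
[m∸1]*n+n≡m*n (suc m) n = +-comm (m * n) n

offset-% : ∀ {N i j D} .{{_ : NonZero N}} → j < N → i + D ≡ j ⊎ i + D ≡ N + j → (i + D) % N ≡ j
offset-% {N} j<N (inj₁ e)         = trans (cong (_% N) e) (m<n⇒m%n≡m j<N)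
offset-% {N} {j = j} j<N (inj₂ e) =
  trans (cong (_% N) (trans e (+-comm N j))) (trans ([m+n]%n≡m%n j N) (m<n⇒m%n≡m j<N))

forward-offset : ∀ {N t j} → t ≤ N → j < N → ∃ λ y → y < N × (t + y ≡ j ⊎ t + y ≡ N + j)
forward-offset {N} {t} {j} t≤N j<N with t ≤? j
... | yes t≤j = j ∸ t , ≤-<-trans (m∸n≤m j t) j<N , inj₁ (m+[n∸m]≡n t≤j)
... | no  t≰j = N + j ∸ t , y<N , inj₂ t+y≡N+j
  where
  open ≤-Reasoning
  t+y≡N+j : t + (N + j ∸ t) ≡ N + j
  t+y≡N+j = m+[n∸m]≡n (≤-trans t≤N (m≤m+n N j))
  y<N : N + j ∸ t < N
  y<N = +-cancelˡ-< t _ N (begin-strict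
    t + (N + j ∸ t)  ≡⟨ t+y≡N+j ⟩
    N + j            <⟨ +-monoʳ-< N (≰⇒> t≰j) ⟩
    N + t            ≡⟨ +-comm N t ⟩
    t + N            ∎)

[m%n+o]%n≡[m+o]%n : ∀ m o n .{{_ : NonZero n}} → (m % n + o) % n ≡ (m + o) % n
[m%n+o]%n≡[m+o]%n m o n = begin
  (m % n + o) % n           ≡⟨ %-distribˡ-+ (m % n) o n ⟩
  (m % n % n + o % n) % n   ≡⟨ cong (λ z → (z + o % n) % n) (m%n%n≡m%n m n) ⟩
  (m % n + o % n) % n       ≡⟨ sym (%-distribˡ-+ m o n) ⟩
  (m + o) % n               ∎
  where open ≡-Reasoning

%-step : ∀ {n} .{{_ : NonZero n}} u s D {w} → w ≡ (u + s) % n → (w + D) % n ≡ (u + (s + D)) % n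
%-step {n} u s D {w} w≡ = begin
  (w + D) % n             ≡⟨ cong (λ z → (z + D) % n) w≡ ⟩
  ((u + s) % n + D) % n   ≡⟨ [m%n+o]%n≡[m+o]%n (u + s) D n ⟩
  (u + s + D) % n         ≡⟨ cong (_% n) (+-assoc u s D) ⟩
  (u + (s + D)) % n       ∎
  where open ≡-Reasoning

∣∸⇔%≡ : ∀ {d m o} .{{_ : NonZero d}} → m ≤ o → d ∣ o ∸ m ⇔ m % d ≡ o % d
∣∸⇔%≡ {d} {m} {o} m≤o = mk⇔ to from
  where
  to : d ∣ o ∸ m → m % d ≡ o % d
  to d∣o∸m = sym (trans (cong (_% d) (sym (m+[n∸m]≡n m≤o))) (%-remove-+ʳ m d∣o∸m))
  from : m % d ≡ o % d → d ∣ o ∸ m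
  from e = divides (o / d ∸ m / d) (begin
    o ∸ m                                       ≡⟨ cong₂ _∸_ (m≡m%n+[m/n]*n o d) (m≡m%n+[m/n]*n m d) ⟩
    (o % d + o / d * d) ∸ (m % d + m / d * d)   ≡⟨ cong (λ z → (z + o / d * d) ∸ (m % d + m / d * d)) (sym e) ⟩
    (m % d + o / d * d) ∸ (m % d + m / d * d)   ≡⟨ [m+n]∸[m+o]≡n∸o (m % d) _ _ ⟩
    o / d * d ∸ m / d * d                       ≡⟨ sym (*-distribʳ-∸ d (o / d) (m / d)) ⟩
    (o / d ∸ m / d) * d                         ∎)
    where open ≡-Reasoning

∣⊖∣⇔%≡ : ∀ {d} .{{_ : NonZero d}} m o → d ∣ ∣ m ⊖ o ∣ ⇔ m % d ≡ o % d
∣⊖∣⇔%≡ {d} m o with ≤-total m o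
... | inj₁ m≤o rewrite ℤP.∣⊖∣-≤ m≤o = ∣∸⇔%≡ m≤o
... | inj₂ o≤m rewrite ℤP.∣m⊖n∣≡∣n⊖m∣ m o | ℤP.∣⊖∣-≤ o≤m =
  mk⇔ (sym ∘ Equivalence.to (∣∸⇔%≡ o≤m)) (Equivalence.from (∣∸⇔%≡ o≤m) ∘ sym)

∣n⇒∣m-n⇔∣m : ∀ d m k → d ℤ∣ k → d ℤ∣ m ℤ- k ⇔ d ℤ∣ m
∣n⇒∣m-n⇔∣m d m k d∣k = mk⇔ to from
  where
  signed : ∀ {z} → d ℤ∣ z → Signed._∣_ d z
  signed {z} = Signed.∣ᵤ⇒∣ {i = z}
  unsigned : ∀ {z} → Signed._∣_ d z → d ℤ∣ z
  unsigned {z} = Signed.∣⇒∣ᵤ {i = z}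
  m-k+k≡m : m ℤ- k ℤ+ k ≡ m
  m-k+k≡m = cancel m k
    where
    cancel : ∀ m k → m ℤ- k ℤ+ k ≡ m
    cancel = ℤ-Solver.solve-∀
  to : d ℤ∣ m ℤ- k → d ℤ∣ m
  to d∣m-k = unsigned (subst (Signed._∣_ d) m-k+k≡m
                               (Signed.∣m∣n⇒∣m+n (signed {m ℤ- k} d∣m-k) (signed {k} d∣k)))
  from : d ℤ∣ m → d ℤ∣ m ℤ- k
  from d∣m = unsigned (Signed.∣m∣n⇒∣m-n (signed {m} d∣m) (signed {k} d∣k))

jump⇔step : ∀ {n} .{{_ : NonZero n}} b {s} → + n ℤ∣ b ℤ- + s → ∀ (u w : Fin n) →
            (+ n ℤ∣ + toℕ w ℤ- (+ toℕ u ℤ+ b)) ⇔ (toℕ w ≡ (toℕ u + s) % n)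
jump⇔step {n} b {s} n∣b-s u w = begin
  + n ℤ∣ + toℕ w ℤ- (+ toℕ u ℤ+ b)                ≡⟨ cong (+ n ℤ∣_) regroup ⟩
  + n ℤ∣ Y ℤ- (b ℤ- + s)                          ≈⟨ ∣n⇒∣m-n⇔∣m (+ n) Y (b ℤ- + s) n∣b-s ⟩
  + n ℤ∣ Y                                        ≡⟨ cong (+ n ℤ∣_) (ℤP.[+m]-[+n]≡m⊖n (toℕ w) (toℕ u + s)) ⟩
  n ∣ ∣ toℕ w ⊖ (toℕ u + s) ∣                     ≈⟨ ∣⊖∣⇔%≡ (toℕ w) (toℕ u + s) ⟩
  toℕ w % n ≡ (toℕ u + s) % n                     ≡⟨ cong (_≡ (toℕ u + s) % n) (m<n⇒m%n≡m (toℕ<n w)) ⟩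
  toℕ w ≡ (toℕ u + s) % n                         ∎
  where
  open SetoidReasoning (⇔-setoid 0ℓ)
  Y : ℤ
  Y = + toℕ w ℤ- + (toℕ u + s)
  identity : ∀ w u s b → w ℤ- (u ℤ+ b) ≡ w ℤ- (u ℤ+ s) ℤ- (b ℤ- s)
  identity = ℤ-Solver.solve-∀
  regroup : + toℕ w ℤ- (+ toℕ u ℤ+ b) ≡ Y ℤ- (b ℤ- + s)
  regroup = trans (identity (+ toℕ w) (+ toℕ u) (+ s) b)
                  (cong (λ t → + toℕ w ℤ- t ℤ- (b ℤ- + s)) (sym (ℤP.pos-+ (toℕ u) s)))

Arc-pair⇔ : ∀ {n} .{{_ : NonZero n}} {b₁ b₂ s₁ s₂} → + n ℤ∣ b₁ ℤ- + s₁ → + n ℤ∣ b₂ ℤ- + s₂ → ∀ u w →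
            Arc n (b₁ ∷ b₂ ∷ []) u w ⇔ (toℕ w ≡ (toℕ u + s₁) % n ⊎ toℕ w ≡ (toℕ u + s₂) % n)
Arc-pair⇔ {b₁ = b₁} {b₂} j₁ j₂ u w = mk⇔ to from
  where
  to : Arc _ _ u w → _
  to (_ , Any.here refl , d)           = inj₁ (Equivalence.to (jump⇔step b₁ j₁ u w) d)
  to (_ , Any.there (Any.here refl) , d) = inj₂ (Equivalence.to (jump⇔step b₂ j₂ u w) d)
  from : _ → Arc _ _ u w
  from (inj₁ e) = _ , Any.here refl , Equivalence.from (jump⇔step b₁ j₁ u w) e
  from (inj₂ e) = _ , Any.there (Any.here refl) , Equivalence.from (jump⇔step b₂ j₂ u w) e

+n∣+m-+m : ∀ n m → + n ℤ∣ + m ℤ- + m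
+n∣+m-+m n m = subst (λ z → + n ℤ∣ z) (sym (ℤP.+-inverseʳ (+ m))) (n ∣0)

∣-[+m]-+n∣≡m+n : ∀ m o → ∣ - (+ m) ℤ- + o ∣ ≡ m + o
∣-[+m]-+n∣≡m+n m o = begin
  ∣ - (+ m) ℤ- + o ∣       ≡⟨ cong ∣_∣ (sym (ℤP.neg-distrib-+ (+ m) (+ o))) ⟩
  ∣ - (+ m ℤ+ + o) ∣       ≡⟨ ℤP.∣-i∣≡∣i∣ (+ m ℤ+ + o) ⟩
  ∣ + m ℤ+ + o ∣           ≡⟨ cong ∣_∣ (sym (ℤP.pos-+ m o)) ⟩
  m + o                    ∎
  where open ≡-Reasoning

Dist-minimal : ∀ {n bs u v m L} → Dist n bs u v m → Walk n bs L u v → m ≤ L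
Dist-minimal (_ , shortest) walk = ≮⇒≥ λ L<m → shortest _ L<m walk

spaced : ℕ → ℕ → ℕ
spaced c i with c ∣? i
... | yes _ = c ∸ 1
... | no  _ = 0

spaced-≤ : ∀ c i → spaced c i ≤ c ∸ 1
spaced-≤ c i with c ∣? i
... | yes _ = ≤-refl
... | no  _ = z≤n

spaced-pos⇒∣ : ∀ c i → 0 < spaced c i → c ∣ i
spaced-pos⇒∣ c i pos with c ∣? i
... | yes c∣i = c∣i
... | no  _   = contradiction pos (<-irrefl refl)

∑-spaced-block : ∀ c .{{_ : NonZero c}} m → ∑[ r < c ] spaced c (m * c + r) ≡ c ∸ 1
∑-spaced-block c m = trans (∑-single _ 0 (>-nonZero⁻¹ c) off-multiples) (at-multiple (m * c + 0) c∣mc+0)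
  where
  c∣mc+0 : c ∣ m * c + 0
  c∣mc+0 = subst (c ∣_) (sym (+-identityʳ (m * c))) (n∣m*n m)
  at-multiple : ∀ i → c ∣ i → spaced c i ≡ c ∸ 1
  at-multiple i c∣i with c ∣? i
  ... | yes _   = refl
  ... | no  c∤i = contradiction c∣i c∤i
  off-multiples : ∀ r → r < c → r ≢ 0 → spaced c (m * c + r) ≡ 0
  off-multiples r r<c r≢0 with c ∣? (m * c + r)
  ... | no  _ = refl
  ... | yes c∣mc+r = contradiction (∣⇒≤ {{≢-nonZero r≢0}} (∣m+n∣m⇒∣n c∣mc+r (n∣m*n m))) (<⇒≱ r<c)

module Circulant (a q : ℕ) .{{_ : NonZero a}} .{{_ : NonZero q}} where

  n : ℕ
  n = q * a

  instance
    n-nonZero : NonZero n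
    n-nonZero = m*n≢0 q a

  ecc : ℕ
  ecc = a ∸ 1 + (q ∸ 1)

  vertex<n : ∀ {s r} → s < q → r < a → s * a + r < n
  vertex<n {s} {r} s<q r<a = begin-strict
    s * a + r   <⟨ +-monoʳ-< (s * a) r<a ⟩
    s * a + a   ≡⟨ +-comm (s * a) a ⟩
    suc s * a   ≤⟨ *-monoˡ-≤ a s<q ⟩
    q * a       ∎
    where open ≤-Reasoning

  vertex-injective : ∀ s s' {r r'} → r < a → r' < a → s * a + r ≡ s' * a + r' → s ≡ s' × r ≡ r'
  vertex-injective s s' {r} {r'} r<a r'<a e = *-cancelʳ-≡ s s' a (+-cancelʳ-≡ r _ _ e') , r≡r'
    where
    column-of : ∀ s r → r < a → (s * a + r) % a ≡ r
    column-of s r r<a = trans (cong (_% a) (+-comm (s * a) r)) (trans ([m+kn]%n≡m%n r s a) (m<n⇒m%n≡m r<a))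
    r≡r' : r ≡ r'
    r≡r' = trans (sym (column-of s r r<a)) (trans (cong (_% a) e) (column-of s' r' r'<a))
    e' : s * a + r ≡ s' * a + r
    e' = trans e (cong (_+_ (s' * a)) (sym r≡r'))

  row-shift : ∀ t y {s r} → s < q → r < a → t + y ≡ s ⊎ t + y ≡ q + s → (t * a + r + y * a) % n ≡ s * a + r
  row-shift t y {s} {r} s<q r<a rows =
    offset-% {i = t * a + r} {D = y * a} (vertex<n s<q r<a) (Sum.map in-range wrapped rows)
    where
    regroup : t * a + r + y * a ≡ (t + y) * a + r
    regroup = lemma t r y a
      where
      lemma : ∀ t r y a → t * a + r + y * a ≡ (t + y) * a + r
      lemma = solve-∀
    in-range : t + y ≡ s → t * a + r + y * a ≡ s * a + r
    in-range e = trans regroup (cong (λ z → z * a + r) e)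
    wrapped : t + y ≡ q + s → t * a + r + y * a ≡ n + (s * a + r)
    wrapped e = trans regroup (trans (cong (λ z → z * a + r) e)
                  (trans (cong (_+ r) (*-distribʳ-+ a q s)) (+-assoc n (s * a) r)))

  -- An independent broadcast of C(n; 1, a) indexed by ℕ: x unit steps and y jumps of length a lead
  -- from v_i to v_{(i + x + y·a) mod n}.
  record Independent (F : ℕ → ℕ) : Set where
    field
      within-ecc : ∀ i → F i ≤ ecc
      far-apart  : ∀ {i j} → i < n → j < n → i ≢ j → 0 < F i → 0 < F j →
                   ∀ x y → (i + (x + y * a)) % n ≡ j → F i < x + y

  cost-bound₁ : ∀ {F k} → 3 ≤ a → q ≡ k * (a ∸ 1) → Independent F → ∑ F n ≤ (q + k) * (a ∸ 2)
  cost-bound₁ {F} {k} 3≤a q≡k*[a∸1] ind = *-cancelˡ-≤ (a ∸ 1) {{a∸1≢0}} (begin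
    (a ∸ 1) * ∑ F n                  ≤⟨ ∑-cyclic-gap-bound (a ∸ 1) (a ∸ 2) gap ⟩
    (a ∸ 2) * n                      ≡⟨ cong ((a ∸ 2) *_) (q*a≡[q+k]*[a∸1] (>-nonZero⁻¹ a) q≡k*[a∸1]) ⟩
    (a ∸ 2) * ((q + k) * (a ∸ 1))    ≡⟨ rearrange (a ∸ 2) (q + k) (a ∸ 1) ⟩
    (a ∸ 1) * ((q + k) * (a ∸ 2))    ∎)
    where
    open ≤-Reasoning
    open Independent ind
    a∸1≢0 : NonZero (a ∸ 1)
    a∸1≢0 = >-nonZero (m<n⇒0<n∸m (≤-trans (s≤s (s≤s z≤n)) 3≤a))
    rearrange : ∀ x y z → x * (y * z) ≡ z * (y * x)
    rearrange = solve-∀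
    gap : ∀ {i j D} → i < n → j < n → 0 < F i → 0 < F j → CyclicGap n i j D → (a ∸ 1) * F i ≤ (a ∸ 2) * D
    gap {i} {j} {D} i<n j<n Fi Fj g with i ≟ j
    ... | yes refl = subst (λ D → (a ∸ 1) * F i ≤ (a ∸ 2) * D) (sym (CyclicGap-self g))
                       (self-gap-bound₁ {k = k} 3≤a (>-nonZero⁻¹ q) q≡k*[a∸1] (within-ecc i))
    ... | no i≢j = subst (λ D → (a ∸ 1) * F i ≤ (a ∸ 2) * D) (sym D≡)
                     (unit-jump-gap-bound 3≤a (far-apart i<n j<n i≢j Fi Fj (D % a) (D / a) reach) (m%n<n D a))
      where
      D≡ : D ≡ D % a + D / a * a
      D≡ = m≡m%n+[m/n]*n D a
      reach : (i + (D % a + D / a * a)) % n ≡ j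
      reach = trans (cong (λ z → (i + z) % n) (sym D≡)) (offset-% {i = i} j<n (CyclicGap⇒offset g))

  column : (ℕ → ℕ) → ℕ → ℕ
  column F r = ∑[ s < q ] F (s * a + r)

  ∑≡∑-column : ∀ F → ∑ F n ≡ ∑ (column F) a
  ∑≡∑-column F = trans (∑-blocks F q a) (∑-comm (λ s r → F (s * a + r)) q a)

  unit-steps-to-column : ∀ {r r' D s} → CyclicGap a r r' D → s < q →
                         ∃ λ t → t ≤ q × s * a + r + D ≡ t * a + r'
  unit-steps-to-column {r} {r'} {D} {s} (ahead _ e) s<q =
    s , <⇒≤ s<q , trans (+-assoc (s * a) r D) (cong (_+_ (s * a)) e)
  unit-steps-to-column {r} {r'} {D} {s} (around _ e) s<q =
    suc s , s<q , trans (+-assoc (s * a) r D) (trans (cong (_+_ (s * a)) e) (regroup s a r'))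
    where
    regroup : ∀ s a r' → s * a + (a + r') ≡ suc s * a + r'
    regroup = solve-∀

  module _ {F : ℕ → ℕ} (ind : Independent F) where
    open Independent ind

    column-light-or-single : ∀ {r} → r < a → column F r ≤ q ∸ 1 ⊎ ∃ λ s → s < q × column F r ≡ F (s * a + r)
    column-light-or-single {r} r<a with anyUpTo? (λ s → q ∸ 1 <? F (s * a + r)) q
    ... | no none-heavy = inj₁ (*-cancelˡ-≤ q (begin
      q * column F r   ≤⟨ ∑-cyclic-gap-bound q (q ∸ 1) {λ s → F (s * a + r)} gap ⟩
      (q ∸ 1) * q      ≡⟨ *-comm (q ∸ 1) q ⟩
      q * (q ∸ 1)      ∎))
      where
      open ≤-Reasoning
      light : ∀ {s} → s < q → F (s * a + r) ≤ q ∸ 1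
      light s<q = ≮⇒≥ λ heavy → none-heavy (_ , s<q , heavy)
      gap : ∀ {s s' D} → s < q → s' < q → 0 < F (s * a + r) → 0 < F (s' * a + r) →
            CyclicGap q s s' D → q * F (s * a + r) ≤ (q ∸ 1) * D
      gap {s} {s'} s<q s'<q Fs Fs' g with s ≟ s'
      ... | yes refl rewrite CyclicGap-self g =
        ≤-trans (*-monoʳ-≤ q (light s<q)) (≤-reflexive (*-comm q (q ∸ 1)))
      ... | no s≢s' = column-gap-bound
              (far-apart (vertex<n s<q r<a) (vertex<n s'<q r<a) (s≢s' ∘ proj₁ ∘ vertex-injective s s' r<a r<a)
                         Fs Fs' 0 _ (row-shift s _ s'<q r<a (CyclicGap⇒offset g)))
              (CyclicGap-≤ s'<q g)
    ... | yes (s , s<q , heavy) = inj₂ (s , s<q , ∑-single _ s s<q others-zero)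
      where
      others-zero : ∀ s' → s' < q → s' ≢ s → F (s' * a + r) ≡ 0
      others-zero s' s'<q s'≢s = n≤0⇒n≡0 (≮⇒≥ λ Fs' →
        let y , y<q , rows = forward-offset (<⇒≤ s<q) s'<q
            Fs<y = far-apart (vertex<n s<q r<a) (vertex<n s'<q r<a)
                             (s'≢s ∘ sym ∘ proj₁ ∘ vertex-injective s s' r<a r<a)
                             (≤-<-trans z≤n heavy) Fs' 0 y (row-shift s y s'<q r<a rows)
        in <-irrefl refl (<-≤-trans heavy (≤-trans (<⇒≤ Fs<y) (∸-monoˡ-≤ 1 y<q))))

    cost-bound₂ : 2 ≤ q → ∑ F n ≤ a * (q ∸ 1)
    cost-bound₂ 2≤q = begin
      ∑ F n                 ≡⟨ trans (∑≡∑-column F) (sym (*-identityˡ _)) ⟩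
      1 * ∑ (column F) a    ≤⟨ ∑-cyclic-gap-bound 1 (q ∸ 1) {column F} gap ⟩
      (q ∸ 1) * a           ≡⟨ *-comm (q ∸ 1) a ⟩
      a * (q ∸ 1)           ∎
      where
      open ≤-Reasoning
      gap : ∀ {r r' D} → r < a → r' < a → 0 < column F r → 0 < column F r' →
            CyclicGap a r r' D → 1 * column F r ≤ (q ∸ 1) * D
      gap {r} {r'} {D} r<a r'<a cr cr' g =
        subst (_≤ (q ∸ 1) * D) (sym (*-identityˡ _)) (bound (column-light-or-single r<a))
        where
        1≤D : 1 ≤ D
        1≤D = CyclicGap-pos r<a g
        bound : column F r ≤ q ∸ 1 ⊎ (∃ λ s → s < q × column F r ≡ F (s * a + r)) →
                column F r ≤ (q ∸ 1) * D
        bound (inj₁ light) = ≤-trans light (m≤m*n (q ∸ 1) D {{>-nonZero 1≤D}})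
        bound (inj₂ (s , s<q , single)) with r ≟ r'
        ... | yes refl rewrite CyclicGap-self g | single = self-gap-bound₂ (>-nonZero⁻¹ a) 2≤q (within-ecc _)
        ... | no r≢r' with ∑-pos _ q cr' | unit-steps-to-column g s<q
        ...   | s' , s'<q , Fs' | t , t≤q , to-column with forward-offset t≤q s'<q
        ...     | y , y<q , rows = subst (_≤ (q ∸ 1) * D) (sym single) (residue-gap-bound 2≤q 1≤D
                    (far-apart (vertex<n s<q r<a) (vertex<n s'<q r'<a)
                               (r≢r' ∘ proj₂ ∘ vertex-injective s s' r<a r'<a)
                               (subst (0 <_) single cr) Fs' D y reach) y<q)
          where
          reach : (s * a + r + (D + y * a)) % n ≡ s' * a + r'
          reach = trans (cong (_% n) (trans (sym (+-assoc (s * a + r) D (y * a))) (cong (_+ y * a) to-column)))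
                        (row-shift t y s'<q r'<a rows)

  steps : ℕ → ℕ
  steps D = D % a + D / a

  steps-+*a : ∀ x y → steps (x + y * a) ≡ x % a + (x / a + y)
  steps-+*a x y = cong₂ _+_ ([m+kn]%n≡m%n x y a)
                            (trans (+-distrib-/-∣ʳ x (n∣m*n y)) (cong (_+_ (x / a)) (m*n/n≡m y a)))

  steps-minimal : ∀ x y → steps ((x + y * a) % n) ≤ x + y
  steps-minimal x y = begin
    m % n % a + m % n / a   ≡⟨ cong₂ _+_ (m∣n⇒o%n%m≡o%m a n m (n∣m*n q)) (m%[n*o]/o≡m/o%n m q a) ⟩
    m % a + m / a % q       ≤⟨ +-monoʳ-≤ (m % a) (m%n≤m (m / a) q) ⟩
    steps m                 ≡⟨ steps-+*a x y ⟩
    x % a + (x / a + y)     ≡⟨ sym (+-assoc (x % a) (x / a) y) ⟩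
    x % a + x / a + y       ≤⟨ +-monoˡ-≤ y x%a+x/a≤x ⟩
    x + y                   ∎
    where
    open ≤-Reasoning
    m : ℕ
    m = x + y * a
    x%a+x/a≤x : x % a + x / a ≤ x
    x%a+x/a≤x = ≤-trans (+-monoʳ-≤ (x % a) (m≤m*n (x / a) a)) (≤-reflexive (sym (m≡m%n+[m/n]*n x a)))

  steps≤ecc : ∀ {D} → D < n → steps D ≤ ecc
  steps≤ecc {D} D<n = +-mono-≤ (∸-monoˡ-≤ 1 (m%n<n D a)) (∸-monoˡ-≤ 1 (m<n*o⇒m/o<n {n = q} D<n))

  steps[n∸1]≡ecc : steps (n ∸ 1) ≡ ecc
  steps[n∸1]≡ecc = begin
    steps (n ∸ 1)                   ≡⟨ cong (λ m → steps (m ∸ 1)) (sym ([m∸1]*n+n≡m*n q a)) ⟩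
    steps ((q ∸ 1) * a + a ∸ 1)     ≡⟨ cong steps (trans (+-∸-assoc ((q ∸ 1) * a) (>-nonZero⁻¹ a)) (+-comm _ (a ∸ 1))) ⟩
    steps (a ∸ 1 + (q ∸ 1) * a)     ≡⟨ steps-+*a (a ∸ 1) (q ∸ 1) ⟩
    (a ∸ 1) % a + ((a ∸ 1) / a + (q ∸ 1))
                                    ≡⟨ cong₂ (λ r d → r + (d + (q ∸ 1))) (m<n⇒m%n≡m a∸1<a) (m<n⇒m/n≡0 a∸1<a) ⟩
    ecc                             ∎
    where
    open ≡-Reasoning
    a∸1<a : a ∸ 1 < a
    a∸1<a = m∸1<m a

  offset : Fin n → Fin n → ℕ
  offset u v = (toℕ v + (n ∸ toℕ u)) % n

  u+[n∸u]≡n : ∀ (u : Fin n) → toℕ u + (n ∸ toℕ u) ≡ n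
  u+[n∸u]≡n u = m+[n∸m]≡n (<⇒≤ (toℕ<n u))

  offset-unique : ∀ {u v} D → (toℕ u + D) % n ≡ toℕ v → offset u v ≡ D % n
  offset-unique {u} {v} D reach = begin
    (toℕ v + (n ∸ toℕ u)) % n               ≡⟨ cong (λ z → (z + (n ∸ toℕ u)) % n) (sym reach) ⟩
    ((toℕ u + D) % n + (n ∸ toℕ u)) % n     ≡⟨ [m%n+o]%n≡[m+o]%n (toℕ u + D) (n ∸ toℕ u) n ⟩
    (toℕ u + D + (n ∸ toℕ u)) % n           ≡⟨ cong (_% n) (xy∙z≈y∙xz (toℕ u) D (n ∸ toℕ u)) ⟩
    (D + (toℕ u + (n ∸ toℕ u))) % n         ≡⟨ cong (λ z → (D + z) % n) (u+[n∸u]≡n u) ⟩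
    (D + n) % n                             ≡⟨ [m+n]%n≡m%n D n ⟩
    D % n                                   ∎
    where open ≡-Reasoning

  offset-reaches : ∀ u v → (toℕ u + offset u v) % n ≡ toℕ v
  offset-reaches u v = begin
    (toℕ u + offset u v) % n                ≡⟨ cong (_% n) (+-comm (toℕ u) (offset u v)) ⟩
    (offset u v + toℕ u) % n                ≡⟨ [m%n+o]%n≡[m+o]%n (toℕ v + (n ∸ toℕ u)) (toℕ u) n ⟩
    (toℕ v + (n ∸ toℕ u) + toℕ u) % n       ≡⟨ cong (_% n) (+-assoc (toℕ v) (n ∸ toℕ u) (toℕ u)) ⟩
    (toℕ v + (n ∸ toℕ u + toℕ u)) % n       ≡⟨ cong (λ z → (toℕ v + z) % n) (m∸n+n≡m (<⇒≤ (toℕ<n u))) ⟩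
    (toℕ v + n) % n                         ≡⟨ [m+n]%n≡m%n (toℕ v) n ⟩
    toℕ v % n                               ≡⟨ m<n⇒m%n≡m (toℕ<n v) ⟩
    toℕ v                                   ∎
    where open ≡-Reasoning

  fin : ℕ → Fin n
  fin i = fromℕ< (m%n<n i n)

  toℕ-fin : ∀ i → toℕ (fin i) ≡ i % n
  toℕ-fin i = toℕ-fromℕ< (m%n<n i n)

  toℕ-fin< : ∀ {i} → i < n → toℕ (fin i) ≡ i
  toℕ-fin< {i} i<n = trans (toℕ-fin i) (m<n⇒m%n≡m i<n)

  fin-toℕ : ∀ u → fin (toℕ u) ≡ u
  fin-toℕ u = toℕ-injective (toℕ-fin< (toℕ<n u))

  cost≡∑ : ∀ f → cost n f ≡ ∑ (f ∘ fin) n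
  cost≡∑ f = cong sum (trans (tabulate-cong (λ u → cong f (sym (fin-toℕ u)))) (tabulate-toℕ n (f ∘ fin)))

  u+0%n≡u : ∀ (u : Fin n) → (toℕ u + 0) % n ≡ toℕ u
  u+0%n≡u u = trans (cong (_% n) (+-identityʳ (toℕ u))) (m<n⇒m%n≡m (toℕ<n u))

  jumps-preserve-multiples : ∀ {c i j} x y → c ∣ n → c ∣ a ∸ 1 → c ∣ i → c ∣ j →
                             (i + (x + y * a)) % n ≡ j → c ∣ x + y
  jumps-preserve-multiples {c} {i} x y c∣n c∣a∸1 c∣i c∣j reach =
    ∣m+n∣m⇒∣n (subst (c ∣_) (+-comm (x + y) _) c∣[x+y]+[a∸1]y) (∣m⇒∣m*n y c∣a∸1)
    where
    regroup : x + y * a ≡ (x + y) + (a ∸ 1) * y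
    regroup = trans (cong (_+_ x) (trans (*-comm y a) (sym ([m∸1]*n+n≡m*n a y)))) (lemma x y (a ∸ 1))
      where
      lemma : ∀ x y d → x + (d * y + y) ≡ x + y + d * y
      lemma = solve-∀
    c∣[x+y]+[a∸1]y : c ∣ (x + y) + (a ∸ 1) * y
    c∣[x+y]+[a∸1]y = subst (c ∣_) regroup (∣m+n∣m⇒∣n (∣n∣m%n⇒∣m c∣n (subst (c ∣_) (sym reach) c∣j)) c∣i)

  cost-spaced : ∀ {c M} .{{_ : NonZero c}} → n ≡ M * c → cost n (spaced c ∘ toℕ) ≡ M * (c ∸ 1)
  cost-spaced {c} {M} n≡M*c = begin
    cost n (spaced c ∘ toℕ)                          ≡⟨ cost≡∑ (spaced c ∘ toℕ) ⟩
    ∑ (spaced c ∘ toℕ ∘ fin) n                       ≡⟨ ∑-cong n (λ i i<n → cong (spaced c) (toℕ-fin< i<n)) ⟩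
    ∑ (spaced c) n                                   ≡⟨ cong (∑ (spaced c)) n≡M*c ⟩
    ∑ (spaced c) (M * c)                             ≡⟨ ∑-blocks (spaced c) M c ⟩
    ∑[ m < M ] ∑[ r < c ] spaced c (m * c + r)       ≡⟨ ∑-cong M (λ m _ → ∑-spaced-block c m) ⟩
    ∑[ _ < M ] (c ∸ 1)                               ≡⟨ ∑-const (c ∸ 1) M ⟩
    M * (c ∸ 1)                                      ∎
    where open ≡-Reasoning


  Step : Fin n → Fin n → Set
  Step u w = toℕ w ≡ (toℕ u + 1) % n ⊎ toℕ w ≡ (toℕ u + a) % n

  Arc⇔Step₁ : ∀ u w → Arc n (+ 1 ∷ + a ∷ []) u w ⇔ Step u w
  Arc⇔Step₁ = Arc-pair⇔ (+n∣+m-+m n 1) (+n∣+m-+m n a)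

  Arc⇔Step₂ : ∀ u w → Arc n (+ 1 ∷ - (+ ((q ∸ 1) * a)) ∷ []) u w ⇔ Step u w
  Arc⇔Step₂ = Arc-pair⇔ (+n∣+m-+m n 1) (subst (n ∣_) (sym ∣-[q∸1]a-a∣≡n) ∣-refl)
    where
    ∣-[q∸1]a-a∣≡n : ∣ - (+ ((q ∸ 1) * a)) ℤ- + a ∣ ≡ n
    ∣-[q∸1]a-a∣≡n = trans (∣-[+m]-+n∣≡m+n ((q ∸ 1) * a) a) ([m∸1]*n+n≡m*n q a)

  module Graph (bs : List ℤ) (arc⇔step : ∀ u w → Arc n bs u w ⇔ Step u w) where

    walk⇒jumps : ∀ {L u v} → Walk n bs L u v →
                 ∃₂ λ x y → x + y ≡ L × (toℕ u + (x + y * a)) % n ≡ toℕ v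
    walk⇒jumps {u = u} here = 0 , 0 , refl , u+0%n≡u u
    walk⇒jumps {u = u} (step {w = w} arc walk) with walk⇒jumps walk | Equivalence.to (arc⇔step u w) arc
    ... | x , y , x+y≡L , reach | inj₁ unit =
      suc x , y , cong suc x+y≡L , trans (sym (%-step {n} (toℕ u) 1 (x + y * a) unit)) reach
    ... | x , y , x+y≡L , reach | inj₂ jump =
      x , suc y , trans (+-suc x y) (cong suc x+y≡L) ,
      trans (cong (λ z → (toℕ u + z) % n) (x∙yz≈y∙xz x a (y * a)))
            (trans (sym (%-step {n} (toℕ u) a (x + y * a) jump)) reach)

    jumps⇒walk : ∀ x y {u v} → (toℕ u + (x + y * a)) % n ≡ toℕ v → Walk n bs (x + y) u v
    jumps⇒walk zero zero {u} reach =
      subst (Walk n bs 0 u) (toℕ-injective (trans (sym (u+0%n≡u u)) reach)) here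
    jumps⇒walk (suc x) y {u} reach =
      step (Equivalence.from (arc⇔step u _) (inj₁ (toℕ-fin (toℕ u + 1))))
           (jumps⇒walk x y (trans (%-step {n} (toℕ u) 1 (x + y * a) (toℕ-fin (toℕ u + 1))) reach))
    jumps⇒walk zero (suc y) {u} reach =
      step (Equivalence.from (arc⇔step u _) (inj₂ (toℕ-fin (toℕ u + a))))
           (jumps⇒walk zero y (trans (%-step {n} (toℕ u) a (y * a) (toℕ-fin (toℕ u + a))) reach))

    dist : ∀ u v → Dist n bs u v (steps (offset u v))
    dist u v = jumps⇒walk (o % a) (o / a) reach , shortest
      where
      o : ℕ
      o = offset u v
      reach : (toℕ u + (o % a + o / a * a)) % n ≡ toℕ v
      reach = trans (cong (λ z → (toℕ u + z) % n) (sym (m≡m%n+[m/n]*n o a))) (offset-reaches u v)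
      shortest : ∀ m → m < steps o → ¬ Walk n bs m u v
      shortest m m<steps walk with walk⇒jumps walk
      ... | x , y , x+y≡m , reach' = <⇒≱ m<steps (begin
        steps o                    ≡⟨ cong steps (offset-unique {u} (x + y * a) reach') ⟩
        steps ((x + y * a) % n)    ≤⟨ steps-minimal x y ⟩
        x + y                      ≡⟨ x+y≡m ⟩
        m                          ∎)
        where open ≤-Reasoning

    Dist≤ecc : ∀ {u v m} → Dist n bs u v m → m ≤ ecc
    Dist≤ecc {u} {v} d = ≤-trans (Dist-minimal d (proj₁ (dist u v))) (steps≤ecc (m%n<n _ n))

    antipode : Fin n → Fin n
    antipode v = fin (toℕ v + (n ∸ 1))

    dist-antipode : ∀ v → Dist n bs v (antipode v) ecc
    dist-antipode v = subst (Dist n bs v (antipode v)) steps≡ecc (dist v (antipode v))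
      where
      steps≡ecc : steps (offset v (antipode v)) ≡ ecc
      steps≡ecc = trans (cong steps (trans (offset-unique (n ∸ 1) (sym (toℕ-fin _))) (m<n⇒m%n≡m (m∸1<m n))))
                        steps[n∸1]≡ecc

    Ecc-everywhere : ∀ v → Ecc n bs v ecc
    Ecc-everywhere v = (λ _ _ → Dist≤ecc) , antipode v , dist-antipode v

    ≤ecc⇒broadcast : ∀ {f : Fin n → ℕ} → (∀ v → f v ≤ ecc) →
      (∀ u v → u ≢ v → 0 < f u → 0 < f v → ∀ m → Dist n bs u v m → f u < m) →
      IndependentBroadcast n bs f
    ≤ecc⇒broadcast f≤ecc apart =
      (λ v δ (≤δ , _) → ≤-trans (f≤ecc v) (≤δ v ecc (Ecc-everywhere v))) ,
      (λ v ε (≤ε , _) → ≤-trans (f≤ecc v) (≤ε (antipode v) ecc (dist-antipode v))) ,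
      apart

    broadcast⇒Independent : ∀ {f} → IndependentBroadcast n bs f → Independent (f ∘ fin)
    broadcast⇒Independent {f} (_ , ≤Ecc , apart) = record
      { within-ecc = λ i → ≤Ecc (fin i) ecc (Ecc-everywhere (fin i))
      ; far-apart  = far
      }
      where
      far : ∀ {i j} → i < n → j < n → i ≢ j → 0 < f (fin i) → 0 < f (fin j) →
            ∀ x y → (i + (x + y * a)) % n ≡ j → f (fin i) < x + y
      far {i} {j} i<n j<n i≢j fi fj x y reach =
        <-≤-trans (apart (fin i) (fin j) fin-i≢fin-j fi fj _ (dist (fin i) (fin j)))
                  (Dist-minimal (dist (fin i) (fin j)) (jumps⇒walk x y reach'))
        where
        fin-i≢fin-j : fin i ≢ fin j
        fin-i≢fin-j e = i≢j (trans (sym (toℕ-fin< i<n)) (trans (cong toℕ e) (toℕ-fin< j<n)))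
        reach' : (toℕ (fin i) + (x + y * a)) % n ≡ toℕ (fin j)
        reach' = trans (cong (λ z → (z + (x + y * a)) % n) (toℕ-fin< i<n)) (trans reach (sym (toℕ-fin< j<n)))

    spaced-broadcast : ∀ {c} .{{_ : NonZero c}} → c ∣ n → c ∣ a ∸ 1 → c ∸ 1 ≤ ecc →
                       IndependentBroadcast n bs (spaced c ∘ toℕ)
    spaced-broadcast {c} c∣n c∣a∸1 c∸1≤ecc =
      ≤ecc⇒broadcast (λ v → ≤-trans (spaced-≤ c (toℕ v)) c∸1≤ecc) apart
      where
      apart : ∀ u v → u ≢ v → 0 < spaced c (toℕ u) → 0 < spaced c (toℕ v) →
              ∀ m → Dist n bs u v m → spaced c (toℕ u) < m
      apart u v u≢v pu pv m (walk , _) with walk⇒jumps walk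
      ... | x , y , refl , reach = ≤-<-trans (spaced-≤ c (toℕ u))
              (c∸1< x y reach (jumps-preserve-multiples x y c∣n c∣a∸1
                                  (spaced-pos⇒∣ c _ pu) (spaced-pos⇒∣ c _ pv) reach))
        where
        c∸1< : ∀ x y → (toℕ u + (x + y * a)) % n ≡ toℕ v → c ∣ x + y → c ∸ 1 < x + y
        c∸1< zero    zero    reach _ = contradiction (toℕ-injective (trans (sym (u+0%n≡u u)) reach)) u≢v
        c∸1< (suc x) y       _     d = <-≤-trans (m∸1<m c) (∣⇒≤ d)
        c∸1< zero    (suc y) _     d = <-≤-trans (m∸1<m c) (∣⇒≤ d)

    β-case₁ : ∀ {k} → 3 ≤ a → q ≡ k * (a ∸ 1) → BroadcastIndependence n bs ((q + k) * (a ∸ 2))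
    β-case₁ {k} 3≤a q≡k*[a∸1] =
      (spaced (a ∸ 1) ∘ toℕ ,
       spaced-broadcast (divides (q + k) n≡[q+k]*[a∸1]) ∣-refl
                        (≤-trans (m∸n≤m (a ∸ 1) 1) (m≤m+n (a ∸ 1) (q ∸ 1))) ,
       trans (cost-spaced {a ∸ 1} {q + k} n≡[q+k]*[a∸1]) (cong (_*_ (q + k)) (∸-+-assoc a 1 1))) ,
      λ f ib → subst (_≤ (q + k) * (a ∸ 2)) (sym (cost≡∑ f))
                     (cost-bound₁ 3≤a q≡k*[a∸1] (broadcast⇒Independent ib))
      where
      instance
        a∸1≢0 : NonZero (a ∸ 1)
        a∸1≢0 = >-nonZero (m<n⇒0<n∸m (≤-trans (s≤s (s≤s z≤n)) 3≤a))
      n≡[q+k]*[a∸1] : n ≡ (q + k) * (a ∸ 1)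
      n≡[q+k]*[a∸1] = q*a≡[q+k]*[a∸1] (>-nonZero⁻¹ a) q≡k*[a∸1]

    β-case₂ : ∀ {k} → 2 ≤ q → a ≡ k * q + 1 → BroadcastIndependence n bs (a * (q ∸ 1))
    β-case₂ {k} 2≤q a≡k*q+1 =
      (spaced q ∘ toℕ ,
       spaced-broadcast (divides a (*-comm q a)) (divides k a∸1≡k*q) (m≤n+m (q ∸ 1) (a ∸ 1)) ,
       cost-spaced {q} {a} (*-comm q a)) ,
      λ f ib → subst (_≤ a * (q ∸ 1)) (sym (cost≡∑ f)) (cost-bound₂ (broadcast⇒Independent ib) 2≤q)
      where
      a∸1≡k*q : a ∸ 1 ≡ k * q
      a∸1≡k*q = trans (cong (_∸ 1) a≡k*q+1) (m+n∸n≡m (k * q) 1)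

theorem26 : (n a q k : ℕ) → n ≡ q * a → 3 ≤ q → 4 ≤ a →
    ((q ≡ k * (a ∸ 1) → 1 ≤ k →
        BroadcastIndependence n (+ 1 ∷ + a ∷ []) ((q + k) * (a ∸ 2)) ×
        BroadcastIndependence n (+ 1 ∷ - (+ ((q ∸ 1) * a)) ∷ []) ((q + k) * (a ∸ 2)))
    × (a ≡ k * q + 1 → 2 ≤ k →
        BroadcastIndependence n (+ 1 ∷ + a ∷ []) (a * (q ∸ 1)) ×
        BroadcastIndependence n (+ 1 ∷ - (+ ((q ∸ 1) * a)) ∷ []) (a * (q ∸ 1))))
theorem26 _ a q k refl 3≤q 4≤a =
  (λ q≡k*[a∸1] _ → G₁.β-case₁ 3≤a q≡k*[a∸1] , G₂.β-case₁ 3≤a q≡k*[a∸1]) ,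
  (λ a≡k*q+1 _ → G₁.β-case₂ {k} 2≤q a≡k*q+1 , G₂.β-case₂ {k} 2≤q a≡k*q+1)
  where
  instance
    a≢0 : NonZero a
    a≢0 = >-nonZero (≤-trans (s≤s z≤n) 4≤a)
    q≢0 : NonZero q
    q≢0 = >-nonZero (≤-trans (s≤s z≤n) 3≤q)
  open Circulant a q
  module G₁ = Graph (+ 1 ∷ + a ∷ []) Arc⇔Step₁
  module G₂ = Graph (+ 1 ∷ - (+ ((q ∸ 1) * a)) ∷ []) Arc⇔Step₂
  3≤a : 3 ≤ a
  3≤a = ≤-trans (n≤1+n 3) 4≤a
  2≤q : 2 ≤ q
  2≤q = ≤-trans (n≤1+n 2) 3≤q
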